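{- Let $d=(d_1,\dots,d_n)$ be a degree sequence with complementary sequence $\overline{d}=(n-1-d_n,\dots,n-1-d_1)$, and let $m=m(d)$ and $\overline{m}=m(\overline{d})$. Then $\Delta_{\overline{m}}(\overline{d})=\Delta_m(d)$.
   Context: A degree sequence is the list of vertex degrees of a finite simple graph in nonincreasing order. $m(d)=\max\{i:d_i\ge i-1\}$. For $k\ge 0$, $\Delta_k(d)=k(k-1)+\sum_{i>k}\min\{k,d_i\}-\sum_{i\le k}d_i$. -}

module Defs where

open import Data.Nat using (ℕ; zero; suc; _+_; _*_; _∸_; _⊔_; _⊓_; _≤?_)
open import Data.Integer as ℤ using (ℤ; +_; -_)
open import Data.Fin using (Fin; toℕ; opposite) renaming (_≤_ to _≤ᶠ_)
open import Data.Bool using (Bool; true; false; if_then_else_)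
open import Data.List using (List; allFin; map; foldr)
open import Data.Product using (Σ; _×_)
open import Relation.Binary.PropositionalEquality using (_≡_)
open import Relation.Nullary.Decidable using (does)

sumℕ : ∀ {n} → (Fin n → ℕ) → ℕ
sumℕ {n} f = foldr _+_ 0 (map f (allFin n))

sumℤ : ∀ {n} → (Fin n → ℤ) → ℤ
sumℤ {n} f = foldr ℤ._+_ (+ 0) (map f (allFin n))

record SimpleGraph (n : ℕ) : Set where
  field
    adj   : Fin n → Fin n → Bool
    sym   : ∀ i j → adj i j ≡ adj j i
    irrefl : ∀ i → adj i i ≡ false

degree : ∀ {n} → SimpleGraph n → Fin n → ℕ
degree G i = sumℕ (λ j → if SimpleGraph.adj G i j then 1 else 0)

-- A sequence d = (d_1,...,d_n), stored 0-indexed: d_i is  d (i-1).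
Nonincreasing : ∀ {n} → (Fin n → ℕ) → Set
Nonincreasing d = ∀ i j → i ≤ᶠ j → d j Data.Nat.≤ d i

IsDegreeSequence : ∀ {n} → (Fin n → ℕ) → Set
IsDegreeSequence {n} d =
  Nonincreasing d × Σ (SimpleGraph n) (λ G → ∀ i → degree G i ≡ d i)

complementSeq : ∀ {n} → (Fin n → ℕ) → (Fin n → ℕ)
complementSeq {n} d i = (n ∸ 1) ∸ d (opposite i)

-- m(d) = max { i ∈ {1..n} : d_i ≥ i - 1 }  (0 if the set is empty, i.e. n = 0)
-- index j : Fin n corresponds to i = toℕ j + 1, so the condition is toℕ j ≤ d j
mOf : ∀ {n} → (Fin n → ℕ) → ℕ
mOf {n} d = foldr _⊔_ 0
  (map (λ j → if does (toℕ j ≤? d j) then suc (toℕ j) else 0) (allFin n))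

Δ : ∀ {n} → ℕ → (Fin n → ℕ) → ℤ
Δ k d = + (k * (k ∸ 1))
  ℤ.+ sumℤ (λ j → if does (suc (toℕ j) ≤? k) then + 0 else + (k ⊓ d j))
  ℤ.- sumℤ (λ j → if does (suc (toℕ j) ≤? k) then + d j else + 0)

-- Call k a split point of d when d_i ≥ k for i ≤ k and d_i ≤ k for i > k (1-indexed); every
-- nonincreasing sequence has one. At a split point the minima in Δ_k(d) disappear, so
-- Δ_k(d) = k(k-1) + Σ_{i>k} d_i - Σ_{i≤k} d_i. Reversing the order of summation turns the two
-- sums of the complement at n - k into k(n-1) - Σ_{i≤k} d_i and (n-k)(n-1) - Σ_{i>k} d_i, which
-- gives Δ_{n-k}(d̄) = Δ_k(d); moreover m(d̄) = n - k exactly. On the other side m(d) is k, or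
-- k + 1 when d_{k+1} = k, and moving that one entry from the tail sum to the head sum does not
-- change Δ.
module Submission where

open import Defs
open import Data.Bool using (true; false; if_then_else_)
open import Data.Fin using (Fin; zero; suc; toℕ; opposite; fromℕ<; punchIn)
open import Data.Fin.Permutation using (reverse)
open import Data.Fin.Properties
  using (toℕ<n; toℕ-fromℕ<; toℕ-injective; opposite-prop; opposite-involutive)
open import Data.Integer as ℤ using (ℤ; _⊖_) renaming (+_ to pos)
import Data.Integer.Properties as ℤ
open import Data.List using ([]; _∷_; allFin; map; foldr; tabulate)
open import Data.List.Properties using (map-tabulate; foldr-preservesᵇ; foldr-preservesᵒ)
import Data.List.Relation.Unary.All.Properties as All
import Data.List.Relation.Unary.Any.Properties as Any
open import Data.Nat
  using (ℕ; zero; suc; _+_; _*_; _∸_; _⊔_; _⊓_; _≤_; _<_; _≤?_; _<?_; z≤n; s≤s; s≤s⁻¹)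
open import Data.Nat.Properties
open import Data.Nat.Tactic.RingSolver using (solve-∀)
open import Data.Product using (_×_; _,_; ∃)
open import Data.Sum using (inj₁; inj₂; [_,_])
open import Data.Vec.Functional using (removeAt)
open import Function using (id; _∘_)
open import Relation.Binary.PropositionalEquality
  using (_≡_; refl; sym; trans; cong; cong₂; subst; module ≡-Reasoning)
open import Relation.Nullary using (Dec; yes; no; contradiction)
open import Relation.Nullary.Decidable using (does)
open import Algebra.Properties.CommutativeMonoid.Sum +-0-commutativeMonoid
  using (sum; sum-cong-≗; ∑-distrib-+; sum-permute; sum-remove; sum-replicate-zero)
open import Algebra.Properties.CommutativeSemigroup +-commutativeSemigroup using (x∙yz≈y∙xz)

open ≡-Reasoning

-- below k f and above k f are f restricted to the paper's indices i ≤ k and i > k (here j = i - 1).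
below above : ∀ {n} → ℕ → (Fin n → ℕ) → Fin n → ℕ
below k f j = if does (suc (toℕ j) ≤? k) then f j else 0
above k f j = if does (suc (toℕ j) ≤? k) then 0 else f j

HeadAtLeast TailAtMost Split : ∀ {n} → ℕ → (Fin n → ℕ) → Set
HeadAtLeast k d = ∀ j → toℕ j < k → k ≤ d j
TailAtMost  k d = ∀ j → k ≤ toℕ j → d j ≤ k
Split       k d = HeadAtLeast k d × TailAtMost k d

Bounded : ∀ {n} → (Fin n → ℕ) → Set
Bounded {n} d = ∀ j → d j ≤ n ∸ 1

m≤n∸1⇒m<n : ∀ {n m} → Fin n → m ≤ n ∸ 1 → m < n
m≤n∸1⇒m<n {suc n} _ m≤n = s≤s m≤n

sumℕ≡sum : ∀ {n} (f : Fin n → ℕ) → sumℕ f ≡ sum f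
sumℕ≡sum f = trans (cong (foldr _+_ 0) (map-tabulate id f)) (foldr-tabulate f)
  where
  foldr-tabulate : ∀ {m} (g : Fin m → ℕ) → foldr _+_ 0 (tabulate g) ≡ sum g
  foldr-tabulate {zero}  g = refl
  foldr-tabulate {suc m} g = cong (g zero +_) (foldr-tabulate (g ∘ suc))

sumℤ≡pos-sum : ∀ {n} {g : Fin n → ℤ} {f : Fin n → ℕ} → (∀ j → g j ≡ pos (f j)) →
  sumℤ g ≡ pos (sum f)
sumℤ≡pos-sum {n} {g} {f} g≗pos∘f = trans (foldr-map (allFin n)) (cong pos (sumℕ≡sum f))
  where
  foldr-map : ∀ js → foldr ℤ._+_ (pos 0) (map g js) ≡ pos (foldr _+_ 0 (map f js))
  foldr-map []       = refl
  foldr-map (j ∷ js) = cong₂ ℤ._+_ (g≗pos∘f j) (foldr-map js)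

sum-bounded : ∀ {n} {f : Fin n → ℕ} {c} → (∀ j → f j ≤ c) → sum f ≤ n * c
sum-bounded {zero}  _   = z≤n
sum-bounded {suc n} f≤c = +-mono-≤ (f≤c zero) (sum-bounded (f≤c ∘ suc))

above-cong : ∀ {n} k {f g : Fin n → ℕ} → (∀ j → k ≤ toℕ j → f j ≡ g j) →
  ∀ j → above k f j ≡ above k g j
above-cong k {f} {g} f≡g j = by-cases (suc (toℕ j) ≤? k)
  where
  by-cases : (p : Dec (toℕ j < k)) → (if does p then 0 else f j) ≡ (if does p then 0 else g j)
  by-cases (yes _)   = refl
  by-cases (no  j≮k) = f≡g j (≮⇒≥ j≮k)

below-+ : ∀ {n} k {f g h : Fin n → ℕ} → (∀ j → f j + g j ≡ h j) →
  ∀ j → below k f j + below k g j ≡ below k h j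
below-+ k {f} {g} {h} f+g≡h j = by-cases (suc (toℕ j) ≤? k)
  where
  by-cases : (p : Dec (toℕ j < k)) →
    (if does p then f j else 0) + (if does p then g j else 0) ≡ (if does p then h j else 0)
  by-cases (yes _) = f+g≡h j
  by-cases (no  _) = refl

sum-below-const : ∀ {n} k c → k ≤ n → sum (below {n} k (λ _ → c)) ≡ k * c
sum-below-const {zero}  zero    c z≤n       = refl
sum-below-const {suc n} zero    c _         = sum-replicate-zero (suc n)
sum-below-const {suc n} (suc k) c (s≤s k≤n) = cong (c +_) (sum-below-const k c k≤n)

sum-below-suc : ∀ {n} (f : Fin n → ℕ) (j : Fin n) →
  sum (below (suc (toℕ j)) f) ≡ f j + sum (below (toℕ j) f)
sum-below-suc f zero    = refl
sum-below-suc f (suc j) = begin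
  f zero + sum (below (suc (toℕ j)) (f ∘ suc))         ≡⟨ cong (f zero +_) (sum-below-suc (f ∘ suc) j) ⟩
  f zero + (f (suc j) + sum (below (toℕ j) (f ∘ suc))) ≡⟨ x∙yz≈y∙xz (f zero) (f (suc j)) _ ⟩
  f (suc j) + (f zero + sum (below (toℕ j) (f ∘ suc))) ∎

sum-above-suc : ∀ {n} (f : Fin n → ℕ) (j : Fin n) →
  sum (above (toℕ j) f) ≡ f j + sum (above (suc (toℕ j)) f)
sum-above-suc f zero    = refl
sum-above-suc f (suc j) = sum-above-suc (f ∘ suc) j

m-n≡o-p : ∀ m n o p → m + p ≡ o + n → pos m ℤ.- pos n ≡ pos o ℤ.- pos p
m-n≡o-p m n o p m+p≡o+n = begin
  pos m ℤ.- pos n   ≡⟨ ℤ.m-n≡m⊖n m n ⟩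
  m ⊖ n             ≡⟨ ℤ.+-cancelˡ-⊖ p m n ⟨
  (p + m) ⊖ (p + n) ≡⟨ cong₂ _⊖_ (trans (+-comm p m) (trans m+p≡o+n (+-comm o n))) (+-comm p n) ⟩
  (n + o) ⊖ (n + p) ≡⟨ ℤ.+-cancelˡ-⊖ n o p ⟩
  o ⊖ p             ≡⟨ ℤ.m-n≡m⊖n o p ⟨
  pos o ℤ.- pos p   ∎

if-pos : ∀ b x y → (if b then pos x else pos y) ≡ pos (if b then x else y)
if-pos true  x y = refl
if-pos false x y = refl

Δ-tailAtMost : ∀ {n k} {d : Fin n → ℕ} → TailAtMost k d →
  Δ k d ≡ pos (k * (k ∸ 1) + sum (above k d)) ℤ.- pos (sum (below k d))
Δ-tailAtMost {k = k} {d} tail = cong₂ (λ x y → pos (k * (k ∸ 1)) ℤ.+ x ℤ.- y)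
  (trans (sumℤ≡pos-sum (λ j → if-pos _ 0 (k ⊓ d j)))
         (cong pos (sum-cong-≗ (above-cong k (λ j k≤j → m≥n⇒m⊓n≡n (tail j k≤j))))))
  (sumℤ≡pos-sum (λ j → if-pos _ (d j) 0))

Δ≡Δ-by-sums : ∀ {n k l} {d e : Fin n → ℕ} → TailAtMost k d → TailAtMost l e →
  k * (k ∸ 1) + sum (above k d) + sum (below l e) ≡ l * (l ∸ 1) + sum (above l e) + sum (below k d) →
  Δ k d ≡ Δ l e
Δ≡Δ-by-sums {k = k} {l} {d} {e} tail-d tail-e sums = begin
  Δ k d                                                          ≡⟨ Δ-tailAtMost tail-d ⟩
  pos (k * (k ∸ 1) + sum (above k d)) ℤ.- pos (sum (below k d)) ≡⟨ m-n≡o-p _ (sum (below k d)) _ (sum (below l e)) sums ⟩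
  pos (l * (l ∸ 1) + sum (above l e)) ℤ.- pos (sum (below l e)) ≡⟨ Δ-tailAtMost tail-e ⟨
  Δ l e                                                          ∎

pronic-suc : ∀ k a b → suc k * k + a + b ≡ k * (k ∸ 1) + (k + a) + (k + b)
pronic-suc zero    a b = refl
pronic-suc (suc k) a b = ring k a b
  where
  ring : ∀ k a b → suc (suc k) * suc k + a + b ≡ suc k * k + (suc k + a) + (suc k + b)
  ring = solve-∀

Δ-suc : ∀ {n k} {d : Fin n → ℕ} (j : Fin n) → toℕ j ≡ k → d j ≡ k → TailAtMost k d →
  Δ (suc k) d ≡ Δ k d
Δ-suc {d = d} j refl dj≡k tail = Δ≡Δ-by-sums tail′ tail (begin
  suc k * k + sum (above (suc k) d) + sum (below k d)               ≡⟨ pronic-suc k _ _ ⟩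
  k * (k ∸ 1) + (k + sum (above (suc k) d)) + (k + sum (below k d)) ≡⟨ cong₂ (λ a b → k * (k ∸ 1) + a + b) above≡ below≡ ⟨
  k * (k ∸ 1) + sum (above k d) + sum (below (suc k) d)             ∎)
  where
  k = toℕ j
  tail′ : TailAtMost (suc k) d
  tail′ i k<i = ≤-trans (tail i (<⇒≤ k<i)) (n≤1+n k)
  above≡ : sum (above k d) ≡ k + sum (above (suc k) d)
  above≡ = trans (sum-above-suc d j) (cong (_+ sum (above (suc k) d)) dj≡k)
  below≡ : sum (below (suc k) d) ≡ k + sum (below k d)
  below≡ = trans (sum-below-suc d j) (cong (_+ sum (below k d)) dj≡k)

≤⇒opposite<∸ : ∀ {n} k (j : Fin n) → k ≤ toℕ j → toℕ (opposite j) < n ∸ k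
≤⇒opposite<∸ {n} k j k≤j =
  subst (_< n ∸ k) (sym (opposite-prop j)) (∸-monoʳ-< (s≤s k≤j) (toℕ<n j))

opposite<∸⇒≤ : ∀ {n} k (j : Fin n) → toℕ (opposite j) < n ∸ k → k ≤ toℕ j
opposite<∸⇒≤ {n} k j o<n∸k =
  ≮⇒≥ (λ j<k → <⇒≱ (subst (_< n ∸ k) (opposite-prop j) o<n∸k) (∸-monoʳ-≤ n j<k))

above-opposite : ∀ {n} k (f : Fin n → ℕ) j → above (n ∸ k) f (opposite j) ≡ below k (f ∘ opposite) j
above-opposite {n} k f j = by-cases (suc (toℕ j) ≤? k) (suc (toℕ (opposite j)) ≤? n ∸ k)
  where
  by-cases : (p : Dec (toℕ j < k)) (q : Dec (toℕ (opposite j) < n ∸ k)) →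
    (if does q then 0 else f (opposite j)) ≡ (if does p then f (opposite j) else 0)
  by-cases (yes j<k) (yes o<n∸k)  = contradiction (opposite<∸⇒≤ k j o<n∸k) (<⇒≱ j<k)
  by-cases (yes _)   (no  _)      = refl
  by-cases (no  _)   (yes _)      = refl
  by-cases (no  j≮k) (no  o≮n∸k) = contradiction (≤⇒opposite<∸ k j (≮⇒≥ j≮k)) o≮n∸k

complementSeq-bounded : ∀ {n} (d : Fin n → ℕ) → Bounded (complementSeq d)
complementSeq-bounded {n} d j = m∸n≤m (n ∸ 1) (d (opposite j))

complementSeq-opposite : ∀ {n} {d : Fin n → ℕ} → Bounded d →
  ∀ j → complementSeq d (opposite j) + d j ≡ n ∸ 1
complementSeq-opposite bounded j rewrite opposite-involutive j = m∸n+n≡m (bounded j)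

complementSeq-involutive : ∀ {n} {d : Fin n → ℕ} → Bounded d →
  ∀ j → complementSeq (complementSeq d) j ≡ d j
complementSeq-involutive bounded j rewrite opposite-involutive j = m∸[m∸n]≡n (bounded j)

sum-above-complementSeq : ∀ {n k} {d : Fin n → ℕ} → k ≤ n → Bounded d →
  sum (above (n ∸ k) (complementSeq d)) + sum (below k d) ≡ k * (n ∸ 1)
sum-above-complementSeq {n} {k} {d} k≤n bounded = begin
  sum (above (n ∸ k) d̄) + sum (below k d)
    ≡⟨ cong (_+ sum (below k d)) (sum-permute (above (n ∸ k) d̄) reverse) ⟩
  sum (above (n ∸ k) d̄ ∘ opposite) + sum (below k d)
    ≡⟨ cong (_+ sum (below k d)) (sum-cong-≗ (above-opposite k d̄)) ⟩
  sum (below k (d̄ ∘ opposite)) + sum (below k d)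
    ≡⟨ ∑-distrib-+ (below k (d̄ ∘ opposite)) (below k d) ⟨
  sum (λ j → below k (d̄ ∘ opposite) j + below k d j)
    ≡⟨ sum-cong-≗ (below-+ k (complementSeq-opposite bounded)) ⟩
  sum (below {n} k (λ _ → n ∸ 1))
    ≡⟨ sum-below-const k (n ∸ 1) k≤n ⟩
  k * (n ∸ 1) ∎
  where
  d̄ = complementSeq d

sum-below-complementSeq : ∀ {n k} {d : Fin n → ℕ} → k ≤ n → Bounded d →
  sum (above k d) + sum (below (n ∸ k) (complementSeq d)) ≡ (n ∸ k) * (n ∸ 1)
sum-below-complementSeq {n} {k} {d} k≤n bounded = begin
  sum (above k d) + sum (below (n ∸ k) d̄)
    ≡⟨ cong (_+ sum (below (n ∸ k) d̄)) d̄̄≡d ⟨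
  sum (above (n ∸ (n ∸ k)) (complementSeq d̄)) + sum (below (n ∸ k) d̄)
    ≡⟨ sum-above-complementSeq {k = n ∸ k} (m∸n≤m n k) (complementSeq-bounded d) ⟩
  (n ∸ k) * (n ∸ 1) ∎
  where
  d̄ = complementSeq d
  d̄̄≡d : sum (above (n ∸ (n ∸ k)) (complementSeq d̄)) ≡ sum (above k d)
  d̄̄≡d = trans (cong (λ m → sum (above m (complementSeq d̄))) (m∸[m∸n]≡n k≤n))
               (sum-cong-≗ (above-cong k (λ j _ → complementSeq-involutive bounded j)))

complementSeq-head : ∀ {n k} {d : Fin n → ℕ} → TailAtMost k d →
  ∀ i → toℕ i < n ∸ k → toℕ i ≤ complementSeq d i
complementSeq-head {n} {k} {d} tail i i<n∸k =
  ≤-trans i≤n∸1∸k (∸-monoʳ-≤ (n ∸ 1) (tail (opposite i) k≤opposite))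
  where
  i≤n∸1∸k : toℕ i ≤ n ∸ 1 ∸ k
  i≤n∸1∸k = subst (toℕ i ≤_) (trans (pred[m∸n]≡m∸[1+n] n k) (sym (∸-+-assoc n 1 k)))
                  (pred-mono-≤ i<n∸k)
  k≤opposite : k ≤ toℕ (opposite i)
  k≤opposite = opposite<∸⇒≤ k (opposite i)
    (subst (_< n ∸ k) (cong toℕ (sym (opposite-involutive i))) i<n∸k)

complementSeq-tail : ∀ {n k} {d : Fin n → ℕ} → HeadAtLeast k d → Bounded d →
  ∀ i → n ∸ k ≤ toℕ i → complementSeq d i < n ∸ k
complementSeq-tail {n} {k} {d} head bounded i n∸k≤i =
  ≤-<-trans (∸-monoʳ-≤ (n ∸ 1) k≤d) n∸1∸k<n∸k
  where
  opposite<k : toℕ (opposite i) < k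
  opposite<k = ≰⇒> (λ k≤o → <⇒≱ (subst (_< n ∸ k) (cong toℕ (opposite-involutive i))
                                       (≤⇒opposite<∸ k (opposite i) k≤o))
                                n∸k≤i)
  k≤d : k ≤ d (opposite i)
  k≤d = head (opposite i) opposite<k
  n∸1∸k<n∸k : n ∸ 1 ∸ k < n ∸ k
  n∸1∸k<n∸k = subst (_< n ∸ k) (sym (∸-+-assoc n 1 k))
    (∸-monoʳ-< (n<1+n k) (m≤n∸1⇒m<n i (≤-trans k≤d (bounded (opposite i)))))

pronic-exchange : ∀ k r → r * (r ∸ 1) + k * (k + r ∸ 1) ≡ k * (k ∸ 1) + r * (k + r ∸ 1)
pronic-exchange zero    r       = +-identityʳ (r * (r ∸ 1))
pronic-exchange (suc k) zero    = ring k
  where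
  ring : ∀ k → suc k * (k + 0) ≡ suc k * k + 0
  ring = solve-∀
pronic-exchange (suc k) (suc r) = ring k r
  where
  ring : ∀ k r → suc r * r + suc k * (k + suc r) ≡ suc k * k + suc r * (k + suc r)
  ring = solve-∀

Δ-complementSeq : ∀ {n k} {d : Fin n → ℕ} → Split k d → k ≤ n → Bounded d →
  Δ (n ∸ k) (complementSeq d) ≡ Δ k d
Δ-complementSeq {n} {k} {d} (head , tail) k≤n bounded = Δ≡Δ-by-sums tail-d̄ tail (begin
  r * (r ∸ 1) + sum (above r d̄) + sum (below k d)
    ≡⟨ +-assoc (r * (r ∸ 1)) _ _ ⟩
  r * (r ∸ 1) + (sum (above r d̄) + sum (below k d))
    ≡⟨ cong (r * (r ∸ 1) +_) (sum-above-complementSeq k≤n bounded) ⟩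
  r * (r ∸ 1) + k * (n ∸ 1)
    ≡⟨ subst (λ m → r * (r ∸ 1) + k * (m ∸ 1) ≡ k * (k ∸ 1) + r * (m ∸ 1))
             (m+[n∸m]≡n k≤n) (pronic-exchange k r) ⟩
  k * (k ∸ 1) + r * (n ∸ 1)
    ≡⟨ cong (k * (k ∸ 1) +_) (sum-below-complementSeq k≤n bounded) ⟨
  k * (k ∸ 1) + (sum (above k d) + sum (below r d̄))
    ≡⟨ +-assoc (k * (k ∸ 1)) _ _ ⟨
  k * (k ∸ 1) + sum (above k d) + sum (below r d̄) ∎)
  where
  r = n ∸ k
  d̄ = complementSeq d
  tail-d̄ : TailAtMost r d̄
  tail-d̄ i r≤i = <⇒≤ (complementSeq-tail head bounded i r≤i)

mOf≡ : ∀ {n} {d : Fin n → ℕ} M → M ≤ n →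
  (∀ j → toℕ j < M → toℕ j ≤ d j) → (∀ j → M ≤ toℕ j → d j < toℕ j) → mOf d ≡ M
mOf≡ {n} {d} M M≤n qualifies fails = ≤-antisym
  (subst (_≤ M) (sym mOf-tabulate)
    (foldr-preservesᵇ {P = _≤ M} {f = _⊔_} ⊔-lub z≤n (All.tabulate⁺ entry≤M)))
  (subst (M ≤_) (sym mOf-tabulate) (M≤max M M≤n qualifies))
  where
  entry : Fin n → ℕ
  entry j = if does (toℕ j ≤? d j) then suc (toℕ j) else 0
  mOf-tabulate : mOf d ≡ foldr _⊔_ 0 (tabulate entry)
  mOf-tabulate = cong (foldr _⊔_ 0) (map-tabulate id entry)
  entry≤M : ∀ j → entry j ≤ M
  entry≤M j = by-cases (toℕ j ≤? d j)
    where
    by-cases : (p : Dec (toℕ j ≤ d j)) → (if does p then suc (toℕ j) else 0) ≤ M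
    by-cases (yes j≤dj) = ≰⇒> (λ M≤j → <⇒≱ (fails j M≤j) j≤dj)
    by-cases (no  _)    = z≤n
  M≤max : ∀ M → M ≤ n → (∀ j → toℕ j < M → toℕ j ≤ d j) → M ≤ foldr _⊔_ 0 (tabulate entry)
  M≤max zero    _   _         = z≤n
  M≤max (suc M) M<n qualifies =
    foldr-preservesᵒ {P = suc M ≤_} {f = _⊔_} (λ x y → [ m≤n⇒m≤n⊔o y , m≤n⇒m≤o⊔n x ])
      0 (tabulate entry) (inj₂ (Any.tabulate⁺ j (by-cases (toℕ j ≤? d j))))
    where
    j = fromℕ< M<n
    j≡M : toℕ j ≡ M
    j≡M = toℕ-fromℕ< M<n
    by-cases : (p : Dec (toℕ j ≤ d j)) → suc M ≤ (if does p then suc (toℕ j) else 0)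
    by-cases (yes _)    = s≤s (≤-reflexive (sym j≡M))
    by-cases (no  j≰dj) = contradiction (qualifies j (s≤s (≤-reflexive j≡M))) j≰dj

mOf-complementSeq : ∀ {n k} {d : Fin n → ℕ} → Split k d → Bounded d →
  mOf (complementSeq d) ≡ n ∸ k
mOf-complementSeq {n} {k} (head , tail) bounded =
  mOf≡ (n ∸ k) (m∸n≤m n k) (complementSeq-head tail)
    (λ i n∸k≤i → <-≤-trans (complementSeq-tail head bounded i n∸k≤i) n∸k≤i)

mOf-split : ∀ {n k} {d : Fin n → ℕ} → Split k d → k ≤ n → (∀ j → toℕ j ≡ k → d j < k) →
  mOf d ≡ k
mOf-split {k = k} {d} (head , tail) k≤n diagonal<k =
  mOf≡ k k≤n (λ j j<k → ≤-trans (<⇒≤ j<k) (head j j<k)) fails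
  where
  fails : ∀ j → k ≤ toℕ j → d j < toℕ j
  fails j k≤j with m≤n⇒m<n∨m≡n k≤j
  ... | inj₁ k<j = ≤-<-trans (tail j k≤j) k<j
  ... | inj₂ k≡j = subst (d j <_) k≡j (diagonal<k j (sym k≡j))

mOf-split-suc : ∀ {n k} {d : Fin n → ℕ} → Split k d → (j : Fin n) → toℕ j ≡ k → d j ≡ k →
  mOf d ≡ suc k
mOf-split-suc {d = d} (head , tail) j refl dj≡j = mOf≡ (suc (toℕ j)) (toℕ<n j) qualifies fails
  where
  qualifies : ∀ i → toℕ i < suc (toℕ j) → toℕ i ≤ d i
  qualifies i i<1+j with m≤n⇒m<n∨m≡n (s≤s⁻¹ i<1+j)
  ... | inj₁ i<j = ≤-trans (<⇒≤ i<j) (head i i<j)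
  ... | inj₂ i≡j = ≤-reflexive (trans i≡j (sym (trans (cong d (toℕ-injective i≡j)) dj≡j)))
  fails : ∀ i → suc (toℕ j) ≤ toℕ i → d i < toℕ i
  fails i j<i = ≤-<-trans (tail i (<⇒≤ j<i)) j<i

Δ-mOf : ∀ {n k} {d : Fin n → ℕ} → Split k d → k ≤ n → Δ (mOf d) d ≡ Δ k d
Δ-mOf {n} {k} {d} split@(_ , tail) k≤n with k <? n
... | no  k≮n = cong (λ m → Δ m d)
  (mOf-split split k≤n (λ j j≡k → contradiction (subst (_< n) j≡k (toℕ<n j)) k≮n))
... | yes k<n = at-diagonal (fromℕ< k<n) (toℕ-fromℕ< k<n)
  where
  at-diagonal : (j : Fin n) → toℕ j ≡ k → Δ (mOf d) d ≡ Δ k d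
  at-diagonal j j≡k with m≤n⇒m<n∨m≡n (tail j (≤-reflexive (sym j≡k)))
  ... | inj₁ dj<k = cong (λ m → Δ m d) (mOf-split split k≤n
    (λ i i≡k → subst (λ i → d i < k) (toℕ-injective (trans j≡k (sym i≡k))) dj<k))
  ... | inj₂ dj≡k = trans (cong (λ m → Δ m d) (mOf-split-suc split j j≡k dj≡k))
                         (Δ-suc j j≡k dj≡k tail)

split-exists : ∀ {n} {d : Fin n → ℕ} → Nonincreasing d → ∃ λ k → k ≤ n × Split k d
split-exists {n} {d} nonincreasing = search n 0 (+-identityʳ n) (λ _ ())
  where
  search : ∀ r k → r + k ≡ n → HeadAtLeast k d → ∃ λ k → k ≤ n × Split k d
  search zero    k k≡n head = k , ≤-reflexive k≡n , head ,
    λ j k≤j → contradiction (subst (_≤ toℕ j) k≡n k≤j) (<⇒≱ (toℕ<n j))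
  search (suc r) k r+k≡n head = extend (fromℕ< k<n) (toℕ-fromℕ< k<n)
    where
    k<n : k < n
    k<n = subst (k <_) r+k≡n (s≤s (m≤n+m k r))
    extend : (j : Fin n) → toℕ j ≡ k → ∃ λ k → k ≤ n × Split k d
    extend j j≡k with d j ≤? k
    ... | yes dj≤k = k , <⇒≤ k<n , head ,
      λ i k≤i → ≤-trans (nonincreasing j i (subst (_≤ toℕ i) (sym j≡k) k≤i)) dj≤k
    ... | no  dj≰k = search r (suc k) (trans (+-suc r k) r+k≡n)
      λ i i<1+k → ≤-trans (≰⇒> dj≰k) (nonincreasing i j (subst (toℕ i ≤_) (sym j≡k) (s≤s⁻¹ i<1+k)))

degree-bounded : ∀ {n} (G : SimpleGraph n) → Bounded (degree G)
degree-bounded {suc n} G i =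
  subst (_≤ n) (sym degree≡)
    (≤-trans (sum-bounded {f = removeAt indicator i} (λ j → indicator≤1 (adj i (punchIn i j))))
             (≤-reflexive (*-identityʳ n)))
  where
  open SimpleGraph G using (adj; irrefl)
  indicator : Fin (suc n) → ℕ
  indicator j = if adj i j then 1 else 0
  indicator≤1 : ∀ b → (if b then 1 else 0) ≤ 1
  indicator≤1 true  = ≤-refl
  indicator≤1 false = z≤n
  degree≡ : degree G i ≡ sum (removeAt indicator i)
  degree≡ = begin
    degree G i                               ≡⟨ sumℕ≡sum indicator ⟩
    sum indicator                            ≡⟨ sum-remove indicator ⟩
    indicator i + sum (removeAt indicator i) ≡⟨ cong (λ b → (if b then 1 else 0) + sum (removeAt indicator i)) (irrefl i) ⟩
    sum (removeAt indicator i)               ∎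

corollary3p6 : (n : ℕ) (d : Fin n → ℕ) → IsDegreeSequence d →
    Δ (mOf (complementSeq d)) (complementSeq d) ≡ Δ (mOf d) d
corollary3p6 n d (nonincreasing , G , degree≡d) with split-exists nonincreasing
... | k , k≤n , split = begin
  Δ (mOf (complementSeq d)) (complementSeq d) ≡⟨ cong (λ m → Δ m (complementSeq d)) (mOf-complementSeq split bounded) ⟩
  Δ (n ∸ k) (complementSeq d)                 ≡⟨ Δ-complementSeq split k≤n bounded ⟩
  Δ k d                                       ≡⟨ Δ-mOf split k≤n ⟨
  Δ (mOf d) d                                 ∎
  where
  bounded : Bounded d
  bounded j = subst (_≤ n ∸ 1) (degree≡d j) (degree-bounded G j)
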